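{- Every $k$-colourable co-chordal graph is compact.
   Context: All graphs are finite and simple; $k$ is a positive integer. A hole is an induced cycle of length at least $5$; an antihole is an induced subgraph whose complement is a hole. A graph is weakly chordal if it has no hole and no antihole. A graph is co-chordal if it contains no induced $\overline{C_4}$ (complement of the $4$-cycle, i.e. two disjoint edges) and no antihole. $N_H(u)$ denotes the neighbourhood of $u$ in $H$. A 2-pair of a graph $H$ is a pair $\{x,y\}$ of distinct nonadjacent vertices such that every chordless path from $x$ to $y$ has length $2$. For a 2-pair $\{x,y\}$ of $H$, $S(x,y)=N_H(x)\cap N_H(y)$ and $C_x$ is the component of $H-S(x,y)$ containing $x$. A weakly chordal graph $G$ is compact if every subgraph $H$ of $G$ either (i) is complete, or (ii) contains a 2-pair $\{x,y\}$ with $N_H(x)\subseteq N_H(y)$, or (iii) contains a 2-pair $\{x,y\}$ such that $C_x\cup S(x,y)$ induces a clique on at most three vertices. -}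

module Defs where

open import Data.Nat using (ℕ; zero; suc; _≤_)
open import Data.Fin using (Fin; toℕ; fromℕ) renaming (zero to fzero)
open import Data.Fin.Subset using (Subset; _∈_)
open import Data.Bool using (Bool; true; false)
open import Data.List using (List; length)
open import Data.List.Membership.Propositional using () renaming (_∈_ to _∈ₗ_)
open import Data.Product using (Σ; ∃; _×_; _,_)
open import Data.Sum using (_⊎_)
open import Relation.Nullary using (¬_)
open import Relation.Binary.PropositionalEquality using (_≡_; _≢_)

record Graph (n : ℕ) : Set where
  field
    edge   : Fin n → Fin n → Bool
    sym    : ∀ u v → edge u v ≡ edge v u
    irrefl : ∀ u → edge u u ≡ false

open Graph public

module _ {n : ℕ} (G : Graph n) where

  Adj : Fin n → Fin n → Set
  Adj u v = edge G u v ≡ true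

  Colourable : ℕ → Set
  Colourable k = Σ (Fin n → Fin k) λ f → ∀ u v → Adj u v → f u ≢ f v

  CycAdj : {m : ℕ} → Fin m → Fin m → Set
  CycAdj {m} i j =
    (suc (toℕ i) ≡ toℕ j) ⊎ (suc (toℕ j) ≡ toℕ i)
    ⊎ ((toℕ i ≡ 0) × (suc (toℕ j) ≡ m))
    ⊎ ((toℕ j ≡ 0) × (suc (toℕ i) ≡ m))

  record Hole : Set where
    field
      len    : ℕ
      len≥5  : 5 ≤ len
      vtx    : Fin len → Fin n
      inj    : ∀ i j → vtx i ≡ vtx j → i ≡ j
      edges  : ∀ i j → CycAdj i j → Adj (vtx i) (vtx j)
      chords : ∀ i j → Adj (vtx i) (vtx j) → CycAdj i j

  record Antihole : Set where
    field
      len    : ℕ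
      len≥5  : 5 ≤ len
      vtx    : Fin len → Fin n
      inj    : ∀ i j → vtx i ≡ vtx j → i ≡ j
      nonadj : ∀ i j → CycAdj i j → ¬ Adj (vtx i) (vtx j)
      adj    : ∀ i j → i ≢ j → ¬ CycAdj i j → Adj (vtx i) (vtx j)

  Induced2K2 : Set
  Induced2K2 = Σ (Fin n) λ a → Σ (Fin n) λ b → Σ (Fin n) λ c → Σ (Fin n) λ d →
    Adj a b × Adj c d × ¬ Adj a c × ¬ Adj a d × ¬ Adj b c × ¬ Adj b d

  WeaklyChordal : Set
  WeaklyChordal = ¬ Hole × ¬ Antihole

  CoChordal : Set
  CoChordal = ¬ Induced2K2 × ¬ Antihole

  -- Notions inside the induced subgraph H = G[U], U a vertex subset

  module _ (U : Subset n) where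

    Consec : {m : ℕ} → Fin m → Fin m → Set
    Consec i j = (suc (toℕ i) ≡ toℕ j) ⊎ (suc (toℕ j) ≡ toℕ i)

    record ChordlessPath (x y : Fin n) (m : ℕ) : Set where
      field
        vtx    : Fin (suc m) → Fin n
        inj    : ∀ i j → vtx i ≡ vtx j → i ≡ j
        inU    : ∀ i → vtx i ∈ U
        start  : vtx fzero ≡ x
        end    : vtx (fromℕ m) ≡ y
        edges  : ∀ i j → Consec i j → Adj (vtx i) (vtx j)
        chords : ∀ i j → Adj (vtx i) (vtx j) → Consec i j

    IsComplete : Set
    IsComplete = ∀ u v → u ∈ U → v ∈ U → u ≢ v → Adj u v

    Is2Pair : Fin n → Fin n → Set
    Is2Pair x y = x ∈ U × y ∈ U × x ≢ y × ¬ Adj x y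
                × (∀ m → ChordlessPath x y m → m ≡ 2)

    NbhdIncl : Fin n → Fin n → Set
    NbhdIncl x y = ∀ z → z ∈ U → Adj x z → Adj y z

    InS : Fin n → Fin n → Fin n → Set
    InS x y z = z ∈ U × Adj x z × Adj y z

    InHminusS : Fin n → Fin n → Fin n → Set
    InHminusS x y z = z ∈ U × ¬ InS x y z

    data Walk (W : Fin n → Set) : Fin n → Fin n → Set where
      here : ∀ {u} → W u → Walk W u u
      step : ∀ {u v w} → W u → Adj u v → Walk W v w → Walk W u w

    InCx : Fin n → Fin n → Fin n → Set
    InCx x y z = Walk (InHminusS x y) x z

    InCxS : Fin n → Fin n → Fin n → Set
    InCxS x y z = InCx x y z ⊎ InS x y z

    SmallClique : Fin n → Fin n → Set
    SmallClique x y =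
      (∀ u v → InCxS x y u → InCxS x y v → u ≢ v → Adj u v)
      × Σ (List (Fin n)) (λ L → length L ≤ 3 × (∀ z → InCxS x y z → z ∈ₗ L))

    CompactCondition : Set
    CompactCondition =
      IsComplete
      ⊎ Σ (Fin n) (λ x → Σ (Fin n) λ y → Is2Pair x y × NbhdIncl x y)
      ⊎ Σ (Fin n) (λ x → Σ (Fin n) λ y → Is2Pair x y × SmallClique x y)

  Compact : Set
  Compact = WeaklyChordal × (∀ (U : Subset n) → CompactCondition U)

-- Let H = G[U] be non-complete and take an antipath p₀ p₁ … pₘ in H (an induced path of the
-- complement) that cannot be extended at p₀. Then N_H(p₁) ⊆ N_H(p₀), which makes {p₁, p₀} a
-- 2-pair. Indeed, a vertex z adjacent to p₁ but not to p₀ is adjacent to some pⱼ, j ≥ 2, since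
-- otherwise z p₀ … pₘ would be a longer antipath; at the first such j, the vertices z p₀ … pⱼ form
-- the complement of a chordless cycle of length j + 2 ≥ 4, i.e. an induced 2K₂ or an antihole.
-- Holes are excluded too: C₅ is self-complementary and a longer hole contains an induced 2K₂.
module Submission where

open import Defs
open import Data.Nat using (ℕ; zero; suc; _+_; _≤_; _<_; z≤n; s≤s)
open import Data.Nat.Properties
  using (≤-refl; ≤-trans; ≤-pred; n≤1+n; n<1+n; m≤n⇒m≤1+n; m≤m+n; 1+n≢n; <-asym; ≤∧≢⇒<; ≤⇒≯;
         suc-injective; m≤n⇒m<n∨m≡n; +-suc)
  renaming (_≟_ to _≟ℕ_)
open import Data.Fin using (Fin; toℕ; fromℕ; #_) renaming (zero to fzero; suc to fsuc; _<_ to _<ᶠ_)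
open import Data.Fin.Properties using (toℕ-fromℕ; toℕ<n; <-cmp; injective⇒≤; any?) renaming (_≟_ to _≟ᶠ_)
open import Data.Fin.Subset using (Subset; _∈_)
open import Data.Fin.Subset.Properties using (_∈?_)
open import Data.Bool using (true)
import Data.Bool.Properties as Bool
open import Data.Product using (Σ; ∃; ∃-syntax; _×_; _,_; proj₁; proj₂)
open import Data.Sum using (_⊎_; inj₁; inj₂)
open import Relation.Binary using (tri<; tri≈; tri>)
open import Relation.Nullary using (¬_; Dec; yes; no; ¬?; contradiction)
open import Relation.Nullary.Decidable
  using (_×-dec_; _⊎-dec_; True; False; toWitness; toWitnessFalse; decidable-stable)
open import Relation.Binary.PropositionalEquality
  using (_≡_; _≢_; refl; trans; cong; subst; subst₂) renaming (sym to ≡-sym)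

symmetric-from-< : ∀ {L} (R : Fin L → Fin L → Set) → (∀ {i j} → R i j → R j i)
                 → (∀ {i j} → i <ᶠ j → R i j) → ∀ {i j} → i ≢ j → R i j
symmetric-from-< R R-sym R< {i} {j} i≢j with <-cmp i j
... | tri< i<j _ _ = R< i<j
... | tri≈ _ i≡j _ = contradiction i≡j i≢j
... | tri> _ _ j<i = R-sym (R< j<i)

injective-from-< : ∀ {L} {A : Set} (f : Fin L → A) → (∀ {i j} → i <ᶠ j → f i ≢ f j)
                 → ∀ {i j} → f i ≡ f j → i ≡ j
injective-from-< f f< {i} {j} e with i ≟ᶠ j
... | yes i≡j = i≡j
... | no i≢j  = contradiction e (symmetric-from-< (λ i j → f i ≢ f j) (λ ne e → ne (≡-sym e)) f< i≢j)

infixr 5 _◂_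
_◂_ : ∀ {A : Set} → A → (ℕ → A) → ℕ → A
(z ◂ p) zero    = z
(z ◂ p) (suc i) = p i

module _ {n : ℕ} (G : Graph n) where

  adj? : ∀ u v → Dec (Adj G u v)
  adj? u v = edge G u v Bool.≟ true

  Adj-sym : ∀ {u v} → Adj G u v → Adj G v u
  Adj-sym {u} {v} = trans (sym G v u)

  Adj-irrefl : ∀ {u} → ¬ Adj G u u
  Adj-irrefl {u} a with () ← trans (≡-sym (irrefl G u)) a

  Adj⇒≢ : ∀ {u v} → Adj G u v → u ≢ v
  Adj⇒≢ a refl = Adj-irrefl a

  NonAdj : Fin n → Fin n → Set
  NonAdj u v = u ≢ v × ¬ Adj G u v

  NonAdj-sym : ∀ {u v} → NonAdj u v → NonAdj v u
  NonAdj-sym (u≢v , ¬a) = (λ e → u≢v (≡-sym e)) , (λ a → ¬a (Adj-sym a))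

  -- Vertices p 0, …, p m; the values of p beyond m are irrelevant.
  record IsAntipath (m : ℕ) (p : ℕ → Fin n) : Set where
    field
      gap   : ∀ {i} → i < m → NonAdj (p i) (p (suc i))
      chord : ∀ {i j} → suc i < j → j ≤ m → Adj G (p i) (p j)

  open IsAntipath public

  antipath-empty : ∀ {p} → IsAntipath 0 p
  antipath-empty = record { gap = λ () ; chord = λ { (s≤s _) () } }

  antipath-prefix : ∀ {m p} → IsAntipath (suc m) p → IsAntipath m p
  antipath-prefix P = record
    { gap   = λ i<m → gap P (m≤n⇒m≤1+n i<m)
    ; chord = λ i+1<j j≤m → chord P i+1<j (m≤n⇒m≤1+n j≤m) }

  antipath-snoc : ∀ {m p} → IsAntipath m p → NonAdj (p m) (p (suc m))
                → (∀ {i} → i < m → Adj G (p i) (p (suc m))) → IsAntipath (suc m) p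
  antipath-snoc {m} {p} P last lastChords = record { gap = gap′ ; chord = chord′ }
    where
    gap′ : ∀ {i} → i < suc m → NonAdj (p i) (p (suc i))
    gap′ i<1+m with m≤n⇒m<n∨m≡n (≤-pred i<1+m)
    ... | inj₁ i<m  = gap P i<m
    ... | inj₂ refl = last
    chord′ : ∀ {i j} → suc i < j → j ≤ suc m → Adj G (p i) (p j)
    chord′ i+1<j j≤1+m with m≤n⇒m<n∨m≡n j≤1+m
    ... | inj₁ j<1+m = chord P i+1<j (≤-pred j<1+m)
    ... | inj₂ refl  = lastChords (≤-pred i+1<j)

  antipath-injective : ∀ {m p} → IsAntipath m p → ∀ {i j} → i < j → j ≤ m → p i ≢ p j
  antipath-injective P {i} {suc j} i<1+j 1+j≤m with m≤n⇒m<n∨m≡n (≤-pred i<1+j)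
  ... | inj₁ i<j  = Adj⇒≢ (chord P (s≤s i<j) 1+j≤m)
  ... | inj₂ refl = proj₁ (gap P 1+j≤m)

  antipath-length : ∀ {m p} → IsAntipath m p → suc m ≤ n
  antipath-length {m} {p} P = injective⇒≤ (injective-from-< (λ i → p (toℕ i)) λ {_} {j} i<j →
    antipath-injective P i<j (≤-pred (toℕ<n j)))

  -- The complement of the chordless cycle q 0, …, q (suc m): the antipath q 0, …, q m,
  -- a last vertex q (suc m), and the closing non-edge between q 0 and q (suc m).
  record IsAnticycle (m : ℕ) (q : ℕ → Fin n) : Set where
    field
      prefix    : IsAntipath m q
      last      : NonAdj (q m) (q (suc m))
      close     : NonAdj (q 0) (q (suc m))
      lastChord : ∀ {i} → suc i < m → Adj G (q (suc i)) (q (suc m))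

  antipath-prepend : ∀ {z p} m → IsAntipath m p → NonAdj z (p 0) → Adj G z (p 1)
                   → IsAntipath (suc m) (z ◂ p) ⊎ ∃[ k ] (2 ≤ k × IsAnticycle k (z ◂ p))
  antipath-prepend zero _ z-p₀ _ = inj₁ (antipath-snoc antipath-empty z-p₀ λ ())
  antipath-prepend {z} {p} (suc m) P z-p₀ z-p₁
    with antipath-prepend m (antipath-prefix P) z-p₀ z-p₁ | adj? z (p (suc m))
  ... | inj₂ C | _       = inj₂ C
  ... | inj₁ Q | yes z-p = inj₁ (antipath-snoc Q (gap P ≤-refl)
    λ { {zero} _ → z-p ; {suc i} i<1+m → chord P i<1+m ≤-refl })
  antipath-prepend (suc zero)    _ _    z-p₁ | inj₁ _ | no ¬z-p = contradiction z-p₁ ¬z-p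
  antipath-prepend (suc (suc m)) P z-p₀ _    | inj₁ Q | no ¬z-p =
    inj₂ (suc (suc m) , s≤s (s≤s z≤n) , record
    { prefix    = Q
    ; last      = gap P ≤-refl
    ; close     = (λ { refl → proj₂ z-p₀ (Adj-sym (chord P (s≤s (s≤s z≤n)) ≤-refl)) }) , ¬z-p
    ; lastChord = λ i+1<m → chord P i+1<m ≤-refl })

  -- CycAdj G {L} i j unfolds to CyclicallyAdjacent L (toℕ i) (toℕ j).
  CyclicallyAdjacent : ℕ → ℕ → ℕ → Set
  CyclicallyAdjacent L a b =
    (suc a ≡ b) ⊎ (suc b ≡ a) ⊎ ((a ≡ 0) × (suc b ≡ L)) ⊎ ((b ≡ 0) × (suc a ≡ L))

  cyclicallyAdjacent? : ∀ L a b → Dec (CyclicallyAdjacent L a b)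
  cyclicallyAdjacent? L a b =
    (suc a ≟ℕ b) ⊎-dec (suc b ≟ℕ a)
    ⊎-dec ((a ≟ℕ 0) ×-dec (suc b ≟ℕ L)) ⊎-dec ((b ≟ℕ 0) ×-dec (suc a ≟ℕ L))

  cyclicallyAdjacent-sym : ∀ {L a b} → CyclicallyAdjacent L a b → CyclicallyAdjacent L b a
  cyclicallyAdjacent-sym (inj₁ e)               = inj₂ (inj₁ e)
  cyclicallyAdjacent-sym (inj₂ (inj₁ e))        = inj₁ e
  cyclicallyAdjacent-sym (inj₂ (inj₂ (inj₁ e))) = inj₂ (inj₂ (inj₂ e))
  cyclicallyAdjacent-sym (inj₂ (inj₂ (inj₂ e))) = inj₂ (inj₂ (inj₁ e))

  cyclicallyAdjacent-irrefl : ∀ {m a} → ¬ CyclicallyAdjacent (suc (suc m)) a a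
  cyclicallyAdjacent-irrefl (inj₁ e)                     = 1+n≢n e
  cyclicallyAdjacent-irrefl (inj₂ (inj₁ e))              = 1+n≢n e
  cyclicallyAdjacent-irrefl (inj₂ (inj₂ (inj₁ (refl , ()))))
  cyclicallyAdjacent-irrefl (inj₂ (inj₂ (inj₂ (refl , ()))))

  anticycle⇒2K2 : ∀ {q} → IsAnticycle 2 q → Induced2K2 G
  anticycle⇒2K2 {q} C =
    q 0 , q 2 , q 1 , q 3 , chord prefix ≤-refl ≤-refl , lastChord ≤-refl
    , proj₂ (gap prefix (s≤s z≤n)) , proj₂ close
    , (λ a → proj₂ (gap prefix ≤-refl) (Adj-sym a)) , proj₂ last
    where open IsAnticycle C

  module _ {m q} (C : IsAnticycle m q) where
    open IsAnticycle C

    private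
      L = suc (suc m)

    anticycle-nonAdj : ∀ {a b} → a < b → b ≤ suc m → CyclicallyAdjacent L a b → NonAdj (q a) (q b)
    anticycle-nonAdj _ a<1+m (inj₁ refl) with m≤n⇒m<n∨m≡n (≤-pred a<1+m)
    ... | inj₁ a<m  = gap prefix a<m
    ... | inj₂ refl = last
    anticycle-nonAdj a<b _ (inj₂ (inj₁ refl)) = contradiction (n<1+n _) (<-asym a<b)
    anticycle-nonAdj _ _ (inj₂ (inj₂ (inj₁ (refl , refl)))) = close
    anticycle-nonAdj () _ (inj₂ (inj₂ (inj₂ (refl , _))))

    anticycle-adj : ∀ {a b} → a < b → b ≤ suc m → ¬ CyclicallyAdjacent L a b → Adj G (q a) (q b)
    anticycle-adj a<b b≤1+m ¬c with m≤n⇒m<n∨m≡n b≤1+m | ≤∧≢⇒< a<b (λ e → ¬c (inj₁ e))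
    ... | inj₁ b<1+m | a+1<b = chord prefix a+1<b (≤-pred b<1+m)
    anticycle-adj {zero}  _ _ ¬c | inj₂ refl | _     = contradiction (inj₂ (inj₂ (inj₁ (refl , refl)))) ¬c
    anticycle-adj {suc a} _ _ _  | inj₂ refl | a+1<b = lastChord (≤-pred a+1<b)

    anticycle⇒antihole : 3 ≤ m → Antihole G
    anticycle⇒antihole 3≤m = record
      { len = L ; len≥5 = s≤s (s≤s 3≤m) ; vtx = vtx ; inj = inj ; nonadj = nonadj ; adj = adj }
      where
      vtx : Fin L → Fin n
      vtx i = q (toℕ i)

      bound : ∀ (j : Fin L) → toℕ j ≤ suc m
      bound j = ≤-pred (toℕ<n j)

      ordered-distinct : ∀ {i j} → i <ᶠ j → vtx i ≢ vtx j
      ordered-distinct {i} {j} i<j with cyclicallyAdjacent? L (toℕ i) (toℕ j)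
      ... | yes c = proj₁ (anticycle-nonAdj i<j (bound j) c)
      ... | no ¬c = Adj⇒≢ (anticycle-adj i<j (bound j) ¬c)

      inj : ∀ i j → vtx i ≡ vtx j → i ≡ j
      inj _ _ = injective-from-< vtx ordered-distinct

      nonadj : ∀ i j → CycAdj G i j → ¬ Adj G (vtx i) (vtx j)
      nonadj i j c = symmetric-from-< (λ i j → CycAdj G i j → ¬ Adj G (vtx i) (vtx j))
        (λ r c a → r (cyclicallyAdjacent-sym c) (Adj-sym a))
        (λ i<j c → proj₂ (anticycle-nonAdj i<j (bound _) c))
        (λ { refl → cyclicallyAdjacent-irrefl c }) c

      adj : ∀ i j → i ≢ j → ¬ CycAdj G i j → Adj G (vtx i) (vtx j)
      adj i j = symmetric-from-< (λ i j → ¬ CycAdj G i j → Adj G (vtx i) (vtx j))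
        (λ r ¬c → Adj-sym (r (λ c → ¬c (cyclicallyAdjacent-sym c))))
        (λ i<j → anticycle-adj i<j (bound _))

  module _ (h : Hole G) where
    open Hole h

    hole-apart : (i j : Fin len) → {False (i ≟ᶠ j)} → {False (cyclicallyAdjacent? len (toℕ i) (toℕ j))}
               → NonAdj (vtx i) (vtx j)
    hole-apart i j {i≢j} {¬c} =
      (λ e → toWitnessFalse i≢j (inj i j e)) , (λ a → toWitnessFalse ¬c (chords i j a))

    hole-near : (i j : Fin len) → {True (cyclicallyAdjacent? len (toℕ i) (toℕ j))} → Adj G (vtx i) (vtx j)
    hole-near i j {c} = edges i j (toWitness c)

  hole⇒2K2⊎anticycle : Hole G → Induced2K2 G ⊎ ∃ (IsAnticycle 3)
  hole⇒2K2⊎anticycle h@record { len = suc (suc (suc (suc (suc zero)))) ; vtx = v } =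
    inj₂ (q , record { prefix = record { gap = gap′ ; chord = chord′ } ; last = apart (# 1) (# 3)
                     ; close = apart (# 0) (# 3) ; lastChord = lastChord′ })
    where
    apart = hole-apart h
    near  = hole-near h
    -- the complement of the pentagon v₀ v₁ v₂ v₃ v₄ is the pentagon v₀ v₂ v₄ v₁ v₃
    q : ℕ → Fin n
    q = v (# 0) ◂ v (# 2) ◂ v (# 4) ◂ v (# 1) ◂ λ _ → v (# 3)
    gap′ : ∀ {i} → i < 3 → NonAdj (q i) (q (suc i))
    gap′ {0} _ = apart (# 0) (# 2)
    gap′ {1} _ = apart (# 2) (# 4)
    gap′ {2} _ = apart (# 4) (# 1)
    gap′ {suc (suc (suc _))} (s≤s (s≤s (s≤s ())))
    chord′ : ∀ {i j} → suc i < j → j ≤ 3 → Adj G (q i) (q j)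
    chord′ {0} {2} _ _ = near (# 0) (# 4)
    chord′ {0} {3} _ _ = near (# 0) (# 1)
    chord′ {1} {3} _ _ = near (# 2) (# 1)
    chord′ {_} {suc (suc (suc (suc _)))} _ (s≤s (s≤s (s≤s ())))
    chord′ {0} {0} ()
    chord′ {0} {1} (s≤s ())
    chord′ {1} {0} ()
    chord′ {1} {1} (s≤s ())
    chord′ {1} {2} (s≤s (s≤s ()))
    chord′ {suc (suc _)} i+1<j j≤3 = contradiction (≤-trans i+1<j j≤3) λ { (s≤s (s≤s (s≤s ()))) }
    lastChord′ : ∀ {i} → suc i < 3 → Adj G (q (suc i)) (q 4)
    lastChord′ {0} _ = near (# 2) (# 3)
    lastChord′ {1} _ = near (# 4) (# 3)
    lastChord′ {suc (suc _)} (s≤s (s≤s (s≤s ())))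
  hole⇒2K2⊎anticycle h@record { len = suc (suc (suc (suc (suc (suc _))))) ; vtx = v } =
    inj₁ (v (# 0) , v (# 1) , v (# 3) , v (# 4) , near (# 0) (# 1) , near (# 3) (# 4)
         , proj₂ (apart (# 0) (# 3)) , proj₂ (apart (# 0) (# 4))
         , proj₂ (apart (# 1) (# 3)) , proj₂ (apart (# 1) (# 4)))
    where
    apart = hole-apart h
    near  = hole-near h
  hole⇒2K2⊎anticycle record { len = 0 ; len≥5 = () }
  hole⇒2K2⊎anticycle record { len = 1 ; len≥5 = s≤s () }
  hole⇒2K2⊎anticycle record { len = 2 ; len≥5 = s≤s (s≤s ()) }
  hole⇒2K2⊎anticycle record { len = 3 ; len≥5 = s≤s (s≤s (s≤s ())) }
  hole⇒2K2⊎anticycle record { len = 4 ; len≥5 = s≤s (s≤s (s≤s (s≤s ()))) }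

  nbhdIncl⊎witness : ∀ U x y → NbhdIncl G U x y ⊎ ∃[ z ] (z ∈ U × Adj G x z × ¬ Adj G y z)
  nbhdIncl⊎witness U x y with any? (λ z → z ∈? U ×-dec adj? x z ×-dec ¬? (adj? y z))
  ... | yes witness = inj₂ witness
  ... | no none     = inj₁ λ z z∈U x-z →
    decidable-stable (adj? y z) λ ¬y-z → none (z , z∈U , x-z , ¬y-z)

  nbhdIncl⇒2-pair : ∀ {U x y} → x ∈ U → y ∈ U → NonAdj x y → NbhdIncl G U x y → Is2Pair G U x y
  nbhdIncl⇒2-pair {U} {x} {y} x∈U y∈U (x≢y , ¬x-y) incl = x∈U , y∈U , x≢y , ¬x-y , length≡2
    where
    length≡2 : ∀ m → ChordlessPath G U x y m → m ≡ 2
    length≡2 zero P = contradiction (trans (≡-sym start) end) x≢y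
      where open ChordlessPath P
    length≡2 (suc zero) P =
      contradiction (subst₂ (Adj G) start end (edges fzero (fsuc fzero) (inj₁ refl))) ¬x-y
      where open ChordlessPath P
    length≡2 (suc (suc m)) P with chords (fromℕ (suc (suc m))) (fsuc fzero) last-u
      where
      open ChordlessPath P
      u = vtx (fsuc fzero)
      x-u : Adj G x u
      x-u = subst (λ w → Adj G w u) start (edges fzero (fsuc fzero) (inj₁ refl))
      last-u : Adj G (vtx (fromℕ (suc (suc m)))) u
      last-u = subst (λ w → Adj G w u) (≡-sym end) (incl u (inU (fsuc fzero)) x-u)
    ... | inj₂ e =
      cong (λ k → suc (suc k)) (trans (≡-sym (toℕ-fromℕ m)) (suc-injective (suc-injective (≡-sym e))))

module _ {n} {G : Graph n} (no2K2 : ¬ Induced2K2 G) (noAntihole : ¬ Antihole G) where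

  anticycle-absurd : ∀ {k q} → 2 ≤ k → ¬ IsAnticycle G k q
  anticycle-absurd {1}                 (s≤s ())
  anticycle-absurd {2}                 _ C = no2K2 (anticycle⇒2K2 G C)
  anticycle-absurd {suc (suc (suc k))} _ C =
    noAntihole (anticycle⇒antihole G C (s≤s (s≤s (s≤s z≤n))))

  noHole : ¬ Hole G
  noHole h with hole⇒2K2⊎anticycle G h
  ... | inj₁ 2K2    = no2K2 2K2
  ... | inj₂ (_ , C) = anticycle-absurd (s≤s (s≤s z≤n)) C

  module _ (U : Subset n) where

    DominatedPair : Set
    DominatedPair = Σ (Fin n) λ x → Σ (Fin n) λ y → x ∈ U × y ∈ U × NonAdj G x y × NbhdIncl G U x y

    InU : ℕ → (ℕ → Fin n) → Set
    InU m p = ∀ {i} → i ≤ m → p i ∈ U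

    ◂-inU : ∀ {m z p} → z ∈ U → InU m p → InU (suc m) (z ◂ p)
    ◂-inU z∈U _   {zero}  _         = z∈U
    ◂-inU _   p∈U {suc _} (s≤s i≤m) = p∈U i≤m

    -- b bounds the number of extensions still possible, since an antipath has at most n vertices.
    antipath⇒dominatedPair : ∀ b {m p} → n ≤ b + m → IsAntipath G (suc m) p → InU (suc m) p
                           → DominatedPair
    antipath⇒dominatedPair zero n≤m P _ =
      contradiction (≤-trans (n≤1+n _) (antipath-length G P)) (≤⇒≯ n≤m)
    antipath⇒dominatedPair (suc b) {m} {p} n≤b+m P p∈U with nbhdIncl⊎witness G U (p 1) (p 0)
    ... | inj₁ incl = p 1 , p 0 , p∈U (s≤s z≤n) , p∈U z≤n , NonAdj-sym G (gap P (s≤s z≤n)) , incl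
    ... | inj₂ (z , z∈U , p₁-z , ¬p₀-z) with antipath-prepend G (suc m) P z-p₀ (Adj-sym G p₁-z)
      where
      z-p₀ : NonAdj G z (p 0)
      z-p₀ = (λ { refl → proj₂ (gap P (s≤s z≤n)) (Adj-sym G p₁-z) }) , (λ a → ¬p₀-z (Adj-sym G a))
    ...   | inj₂ (_ , 2≤k , C) = contradiction C (anticycle-absurd 2≤k)
    ...   | inj₁ Q = antipath⇒dominatedPair b (subst (n ≤_) (≡-sym (+-suc b m)) n≤b+m) Q (◂-inU z∈U p∈U)

    nonAdjPair⇒dominatedPair : ∀ {u v} → u ∈ U → v ∈ U → NonAdj G u v → DominatedPair
    nonAdjPair⇒dominatedPair {u} {v} u∈U v∈U u-v =
      antipath⇒dominatedPair n {p = u ◂ λ _ → v} (m≤m+n n 0)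
        (antipath-snoc G (antipath-empty G) u-v λ ()) (◂-inU u∈U λ _ → v∈U)

    compactCondition : CompactCondition G U
    compactCondition
      with any? (λ u → any? (λ v → u ∈? U ×-dec v ∈? U ×-dec ¬? (u ≟ᶠ v) ×-dec ¬? (adj? G u v)))
    ... | no none = inj₁ λ u v u∈U v∈U u≢v →
      decidable-stable (adj? G u v) λ ¬u-v → none (u , v , u∈U , v∈U , u≢v , ¬u-v)
    ... | yes (u , v , u∈U , v∈U , u-v) with nonAdjPair⇒dominatedPair u∈U v∈U u-v
    ... | x , y , x∈U , y∈U , x-y , incl =
      inj₂ (inj₁ (x , y , nbhdIncl⇒2-pair G x∈U y∈U x-y incl , incl))

lemma2 : ∀ (k n : ℕ) → 1 ≤ k → (G : Graph n) → Colourable G k → CoChordal G → Compact G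
lemma2 _ _ _ G _ (no2K2 , noAntihole) =
  (noHole no2K2 noAntihole , noAntihole) , compactCondition no2K2 noAntihole
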